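{- Let $k \ge 3$ and $m,n \ge 2$ be integers. Then $\alpha(\mathcal{L}_{m,n}) < m + (k-2)n$.
   Context: $\mathcal{L}_{m,n}$ is the $k$-graph with vertex set $[m]\times[n]$ whose edges are all sets $\{(x_1,y_1),(x_1,y_2),(x_2,y_2),\dots,(x_{k-1},y_2)\}$ with $x_1 < x_2 < \cdots < x_{k-1}$ in $[m]$ and $y_1 > y_2$ in $[n]$. $\alpha$ denotes the maximum size of a vertex set containing no edge. -}

module Defs where

open import Data.Nat using (ℕ; suc; _∸_)
open import Data.Fin using (Fin; zero; _<_; _>_)
open import Data.Product using (_×_; _,_; ∃-syntax; Σ-syntax)
open import Data.List using (List)
open import Data.List.Membership.Propositional using (_∈_)
open import Relation.Nullary using (¬_)

-- Vertices of L_{m,n}: [m] × [n], modelled as Fin m × Fin n (order-preserving relabelling).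
Vertex : ℕ → ℕ → Set
Vertex m n = Fin m × Fin n

StrictlyIncreasing : ∀ {l m} → (Fin l → Fin m) → Set
StrictlyIncreasing x = ∀ i j → i < j → x i < x j

-- The k-graph L_{m,n}: an edge is determined by x : Fin (k-1) → Fin m strictly
-- increasing (written with index set Fin (suc (k ∸ 2)), which is Fin (k-1) for k ≥ 2)
-- and y₁ > y₂; its vertex set is {(x₁,y₁)} ∪ {(xᵢ,y₂) : 1 ≤ i ≤ k-1}.
EdgeIn : ∀ k {m n} → List (Vertex m n) →
         (Fin (suc (k ∸ 2)) → Fin m) → Fin n → Fin n → Set
EdgeIn k S x y₁ y₂ = ((x zero , y₁) ∈ S) × (∀ i → (x i , y₂) ∈ S)

ContainsEdge : ∀ k {m n} → List (Vertex m n) → Set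
ContainsEdge k {m} {n} S =
  ∃[ x ] ∃[ y₁ ] ∃[ y₂ ] (StrictlyIncreasing x × y₁ > y₂ × EdgeIn k S x y₁ y₂)

Independent : ∀ k {m n} → List (Vertex m n) → Set
Independent k S = ¬ ContainsEdge k S

-- Call a vertex of S covered when S has a vertex strictly above it in the same column.
-- The uncovered vertices of S lie in distinct columns, so there are at most m of them.
-- Covered vertices avoid the top row, and no row holds k − 1 of them: ordering their
-- columns x₁ < ⋯ < x_{k−1}, the vertex of S above (x₁ , y) completes an edge.
-- Hence |S| ≤ m + (n − 1)(k − 2) < m + (k − 2)n.
module Submission where

open import Defs
open import Data.Nat using (ℕ; zero; suc; _≤_; _<_; _+_; _*_; _∸_; z≤n; s≤s; s≤s⁻¹)
import Data.Nat as ℕ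
open import Data.Nat.Properties
  using (+-suc; +-comm; *-comm; *-identityʳ; +-mono-≤; +-monoʳ-<; *-monoʳ-<; ≤-refl; ≤-trans; ≤-reflexive;
         ≤∧≢⇒<; ≮⇒≥; m<n⇒m<1+n; n<1+n; m∸n≤m; ∸-monoˡ-≤; module ≤-Reasoning)
open import Data.Fin as Fin using (Fin; zero; suc; toℕ; fromℕ<)
open import Data.Fin.Properties using (toℕ<n; toℕ-injective; toℕ-fromℕ<)
import Data.Fin.Properties as Fin
open import Data.Product using (Σ-syntax; _×_; _,_; proj₁; proj₂; uncurry)
open import Data.Product.Properties using (×-≡,≡→≡)
open import Data.Empty using (⊥-elim)
open import Data.List using (List; []; _∷_; length; map; filter)
open import Data.List.Properties using (length-map)
open import Data.List.Membership.Propositional using (_∈_; find; lose)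
open import Data.List.Membership.Propositional.Properties using (∈-filter⁻)
open import Data.List.Relation.Unary.Any using (Any; here; there; any?)
open import Data.List.Relation.Unary.All as All using (All; []; _∷_)
import Data.List.Relation.Unary.All.Properties as All
open import Data.List.Relation.Unary.AllPairs as AllPairs using (AllPairs; []; _∷_)
open import Data.List.Relation.Unary.Unique.Propositional using (Unique)
import Data.List.Relation.Unary.Unique.Propositional.Properties as Unique
open import Data.List.Relation.Binary.Permutation.Propositional using (↭-sym; ↭⇒↭ₛ)
open import Data.List.Relation.Binary.Permutation.Propositional.Properties using (∈-resp-↭; ↭-length)
import Data.List.Relation.Binary.Permutation.Setoid.Properties as Permutationₛ
open import Data.List.Relation.Binary.Sublist.Propositional.Properties using (filter-⊆; filter⁺; length-mono-≤)
open import Data.List.Relation.Unary.Sorted.TotalOrder.Properties using (Sorted⇒AllPairs)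
import Data.List.Sort as Sort
open import Function using (_∘_)
open import Relation.Binary.Bundles using (DecTotalOrder)
open import Relation.Binary.PropositionalEquality
open import Relation.Binary.Definitions using (tri<; tri≈; tri>)
open import Relation.Nullary using (¬_; yes; no)
open import Relation.Nullary.Decidable using (_×-dec_)
open import Relation.Unary using (Decidable)
open import Relation.Unary.Properties using (∁?)

module _ {A : Set} where

  length-filter+∁ : {P : A → Set} (P? : Decidable P) (xs : List A) →
    length xs ≡ length (filter P? xs) + length (filter (∁? P?) xs)
  length-filter+∁ P? [] = refl
  length-filter+∁ P? (x ∷ xs) with P? x
  ... | yes _ = cong suc (length-filter+∁ P? xs)
  ... | no _ = trans (cong suc (length-filter+∁ P? xs)) (sym (+-suc _ _))

  ∈-filter²⁻ : {P Q : A → Set} (P? : Decidable P) (Q? : Decidable Q) {a : A} {xs : List A} →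
    a ∈ filter Q? (filter P? xs) → a ∈ xs × P a × Q a
  ∈-filter²⁻ P? Q? a∈ =
    let a∈P , qa = ∈-filter⁻ Q? a∈
        a∈xs , pa = ∈-filter⁻ P? a∈P
    in a∈xs , pa , qa

  length≤1 : {xs : List A} → Unique xs → (∀ {a b} → a ∈ xs → b ∈ xs → a ≡ b) → length xs ≤ 1
  length≤1 [] _ = z≤n
  length≤1 (_ ∷ []) _ = s≤s z≤n
  length≤1 ((a≢b ∷ _) ∷ _) all-equal = ⊥-elim (a≢b (all-equal (here refl) (there (here refl))))

  Unique-map⁺ : {B : Set} {f : A → B} {xs : List A} →
    (∀ {a b} → a ∈ xs → b ∈ xs → f a ≡ f b → a ≡ b) → Unique xs → Unique (map f xs)
  Unique-map⁺ inj [] = []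
  Unique-map⁺ inj (a∉ ∷ distinct) =
    All.map⁺ (All.tabulate λ b∈ fa≡fb → All.lookup a∉ b∈ (inj (here refl) (there b∈) fa≡fb))
    ∷ Unique-map⁺ (λ a∈ b∈ → inj (there a∈) (there b∈)) distinct

  length≤-fibres : (g : A → ℕ) (r c : ℕ) (xs : List A) → All (λ a → g a < r) xs →
    (∀ {z} → z < r → length (filter (λ a → g a ℕ.≟ z) xs) ≤ c) → length xs ≤ r * c
  length≤-fibres g zero c [] _ _ = z≤n
  length≤-fibres g zero c (_ ∷ _) (() ∷ _) _
  length≤-fibres g (suc r) c xs below fibre = begin
      length xs                                ≡⟨ length-filter+∁ at? xs ⟩
      length (filter at? xs) + length rest     ≤⟨ +-mono-≤ (fibre ≤-refl)
                                                           (length≤-fibres g r c rest rest-below rest-fibre) ⟩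
      c + r * c                                ∎
    where
    open ≤-Reasoning
    at? : Decidable (λ a → g a ≡ r)
    at? a = g a ℕ.≟ r
    rest : List A
    rest = filter (∁? at?) xs
    rest-below : All (λ a → g a < r) rest
    rest-below = All.zipWith (λ (g<1+r , g≢r) → ≤∧≢⇒< (s≤s⁻¹ g<1+r) g≢r)
                   (All.filter⁺ (∁? at?) below , All.all-filter (∁? at?) xs)
    rest-fibre : ∀ {z} → z < r → length (filter (λ a → g a ℕ.≟ z) rest) ≤ c
    rest-fibre z<r = ≤-trans (length-mono-≤ (filter⁺ _ _ (λ { refl p → p }) (filter-⊆ (∁? at?) xs)))
                             (fibre (m<n⇒m<1+n z<r))

  AllPairs⇒selection : {R : A → A → Set} {xs : List A} → AllPairs R xs → (l : ℕ) → l ≤ length xs →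
    Σ[ x ∈ (Fin l → A) ] (∀ i j → i Fin.< j → R (x i) (x j)) × (∀ i → x i ∈ xs)
  AllPairs⇒selection _ zero _ = (λ ()) , (λ ()) , (λ ())
  AllPairs⇒selection {R} {a ∷ xs} (a~xs ∷ pairs) (suc l) (s≤s l≤) = y , y↗ , y∈
    where
    selection = AllPairs⇒selection pairs l l≤
    x = proj₁ selection
    y : Fin (suc l) → A
    y zero = a
    y (suc i) = x i
    y↗ : ∀ i j → i Fin.< j → R (y i) (y j)
    y↗ zero (suc j) _ = All.lookup a~xs (proj₂ (proj₂ selection) j)
    y↗ (suc i) (suc j) i<j = proj₁ (proj₂ selection) i j (s≤s⁻¹ i<j)
    y∈ : ∀ i → y i ∈ a ∷ xs
    y∈ zero = here refl
    y∈ (suc i) = there (proj₂ (proj₂ selection) i)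

module _ {m : ℕ} where
  open Sort (Fin.≤-decTotalOrder m) using (sort; sort-↭; sort-↗)

  increasing-selection : (xs : List (Fin m)) → Unique xs → (l : ℕ) → l ≤ length xs →
    Σ[ x ∈ (Fin l → Fin m) ] StrictlyIncreasing x × (∀ i → x i ∈ xs)
  increasing-selection xs distinct l l≤ =
    let x , x↗ , x∈ = AllPairs⇒selection sorted< l (≤-trans l≤ (≤-reflexive (sym (↭-length (sort-↭ xs)))))
    in x , x↗ , λ i → ∈-resp-↭ (sort-↭ xs) (x∈ i)
    where
    sorted< : AllPairs Fin._<_ (sort xs)
    sorted< = AllPairs.zipWith (uncurry Fin.≤∧≢⇒<)
      ( Sorted⇒AllPairs (DecTotalOrder.totalOrder (Fin.≤-decTotalOrder m)) (sort-↗ xs)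
      , Permutationₛ.Unique-resp-↭ (setoid (Fin m)) (↭⇒↭ₛ (↭-sym (sort-↭ xs))) distinct)

module _ {m n : ℕ} (S : List (Vertex m n)) where

  Covered : Vertex m n → Set
  Covered (x , y) = Any (λ (x' , y') → x' ≡ x × y Fin.< y') S

  covered? : Decidable Covered
  covered? (x , y) = any? (λ (x' , y') → (x' Fin.≟ x) ×-dec (y Fin.<? y')) S

  uncovered-column-injective : ∀ {a b} → a ∈ S → b ∈ S → ¬ Covered a → ¬ Covered b →
    proj₁ a ≡ proj₁ b → a ≡ b
  uncovered-column-injective {x , y} {.x , y'} a∈ b∈ a↑ b↑ refl with Fin.<-cmp y y'
  ... | tri< y<y' _ _ = ⊥-elim (a↑ (lose b∈ (refl , y<y')))
  ... | tri≈ _ refl _ = refl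
  ... | tri> _ _ y'<y = ⊥-elim (b↑ (lose a∈ (refl , y'<y)))

  covered-row< : ∀ {a} → Covered a → toℕ (proj₂ a) < n ∸ 1
  covered-row< a↑ =
    let (_ , y') , _ , _ , y<y' = find a↑
    in ≤-trans y<y' (∸-monoˡ-≤ 1 (toℕ<n y'))

  covered-row⇒edge : ∀ k (y : Fin n) (xs : List (Fin m)) → Unique xs → suc (k ∸ 2) ≤ length xs →
    All (λ x → (x , y) ∈ S × Covered (x , y)) xs → ContainsEdge k S
  covered-row⇒edge k y xs distinct long inRow
    with x , x↗ , x∈ ← increasing-selection xs distinct (suc (k ∸ 2)) long
    with (_ , y₁) , top∈ , refl , y<y₁ ← find (proj₂ (All.lookup inRow (x∈ zero)))
    = x , y₁ , y , x↗ , y<y₁ , top∈ , λ i → proj₁ (All.lookup inRow (x∈ i))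

  module _ (distinct : Unique S) where

    length-uncovered≤ : length (filter (∁? covered?) S) ≤ m
    length-uncovered≤ = ≤-trans
      (length≤-fibres column m 1 (filter (∁? covered?) S) (All.tabulate λ {a} _ → toℕ<n (proj₁ a)) column-fibre)
      (≤-reflexive (*-identityʳ m))
      where
      column : Vertex m n → ℕ
      column = toℕ ∘ proj₁
      column-fibre : ∀ {z} → z < m → length (filter (λ a → column a ℕ.≟ z) (filter (∁? covered?) S)) ≤ 1
      column-fibre {z} _ = length≤1 (Unique.filter⁺ _ (Unique.filter⁺ _ distinct)) same-vertex
        where
        in-column-z? : Decidable (λ a → column a ≡ z)
        in-column-z? a = column a ℕ.≟ z
        same-vertex : ∀ {a b} → a ∈ filter in-column-z? (filter (∁? covered?) S) →
          b ∈ filter in-column-z? (filter (∁? covered?) S) → a ≡ b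
        same-vertex a∈ b∈ =
          let a∈S , a↑ , a-in-z = ∈-filter²⁻ (∁? covered?) in-column-z? a∈
              b∈S , b↑ , b-in-z = ∈-filter²⁻ (∁? covered?) in-column-z? b∈
          in uncovered-column-injective a∈S b∈S a↑ b↑ (toℕ-injective (trans a-in-z (sym b-in-z)))

    length-covered≤ : ∀ k → Independent k S → length (filter covered? S) ≤ (n ∸ 1) * (k ∸ 2)
    length-covered≤ k independent =
      length≤-fibres row (n ∸ 1) (k ∸ 2) (filter covered? S)
        (All.tabulate λ a∈ → covered-row< (proj₂ (∈-filter⁻ covered? {xs = S} a∈))) row-fibre
      where
      row : Vertex m n → ℕ
      row = toℕ ∘ proj₂
      row-fibre : ∀ {z} → z < n ∸ 1 → length (filter (λ a → row a ℕ.≟ z) (filter covered? S)) ≤ k ∸ 2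
      row-fibre {z} z<n-1 = ≮⇒≥ λ long → independent (covered-row⇒edge k y (map proj₁ F)
          (Unique-map⁺ column-injective (Unique.filter⁺ _ (Unique.filter⁺ _ distinct)))
          (≤-trans long (≤-reflexive (sym (length-map proj₁ F))))
          (All.map⁺ (All.tabulate in-row-y)))
        where
        in-row-z? : Decidable (λ a → row a ≡ z)
        in-row-z? a = row a ℕ.≟ z
        F : List (Vertex m n)
        F = filter in-row-z? (filter covered? S)
        ∈F⁻ : ∀ {a} → a ∈ F → a ∈ S × Covered a × row a ≡ z
        ∈F⁻ = ∈-filter²⁻ covered? in-row-z?
        y : Fin n
        y = fromℕ< (≤-trans z<n-1 (m∸n≤m n 1))
        row≡y : ∀ {a} → a ∈ F → proj₂ a ≡ y
        row≡y a∈ = toℕ-injective (trans (proj₂ (proj₂ (∈F⁻ a∈))) (sym (toℕ-fromℕ< _)))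
        column-injective : ∀ {a b} → a ∈ F → b ∈ F → proj₁ a ≡ proj₁ b → a ≡ b
        column-injective a∈ b∈ same-column = ×-≡,≡→≡ (same-column , trans (row≡y a∈) (sym (row≡y b∈)))
        in-row-y : ∀ {a} → a ∈ F → (proj₁ a , y) ∈ S × Covered (proj₁ a , y)
        in-row-y {x , y'} a∈ =
          let a∈S , a↑ , _ = ∈F⁻ a∈
          in subst (λ y' → (x , y') ∈ S × Covered (x , y')) (row≡y a∈) (a∈S , a↑)

proposition5p2 : (k m n : ℕ) → 3 ≤ k → 2 ≤ m → 2 ≤ n →
    (S : List (Vertex m n)) → Unique S → Independent k S →
    length S < m + (k ∸ 2) * n
proposition5p2 k@(suc (suc (suc c))) m (suc n′) (s≤s (s≤s (s≤s _))) _ (s≤s _) S distinct independent =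
  begin-strict
    length S                                  ≡⟨ length-filter+∁ (covered? S) S ⟩
    length (filter (covered? S) S) + length (filter (∁? (covered? S)) S)
                                              ≤⟨ +-mono-≤ (length-covered≤ S distinct k independent)
                                                          (length-uncovered≤ S distinct) ⟩
    n′ * suc c + m                            ≡⟨ +-comm (n′ * suc c) m ⟩
    m + n′ * suc c                            ≡⟨ cong (m +_) (*-comm n′ (suc c)) ⟩
    m + suc c * n′                            <⟨ +-monoʳ-< m (*-monoʳ-< (suc c) (n<1+n n′)) ⟩
    m + suc c * suc n′                        ∎
  where open ≤-Reasoning
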